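{- For any positive integer $n$, $$\det[2^{|j-k|}+\delta_{jk}]_{1\le j,k\le n}=(-2)^n\left(\frac{n+1}{3}\right),$$ where $\delta_{jk}$ is $1$ if $j=k$ and $0$ otherwise.
   Context: For an integer $m$, $\left(\frac{m}{3}\right)$ is the Legendre symbol modulo $3$: it equals $0$ if $3\mid m$, $1$ if $m\equiv1\pmod3$, and $-1$ if $m\equiv2\pmod3$. -}

module Defs where

open import Data.Nat as ℕ using (ℕ; zero; suc; ∣_-_∣)
open import Data.Nat.DivMod using (_%_)
open import Data.Integer as ℤ using (ℤ; +_; -_; _+_; _*_; _^_; 0ℤ; 1ℤ)
open import Data.Fin using (Fin; zero; suc; toℕ; punchIn)

Matrix : ℕ → Set
Matrix n = Fin n → Fin n → ℤ

minor : ∀ {n} → Matrix (suc n) → Fin (suc n) → Matrix n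
minor A j r c = A (suc r) (punchIn j c)

altSum : ∀ {m} → (Fin m → ℤ) → ℤ
altSum {zero}  f = 0ℤ
altSum {suc m} f = f zero + (- altSum (λ j → f (suc j)))

det : ∀ {n} → Matrix n → ℤ
det {zero}  A = 1ℤ
det {suc n} A = altSum (λ j → A zero j * det (minor A j))

δ : ∀ {n} → Fin n → Fin n → ℤ
δ zero    zero    = 1ℤ
δ zero    (suc k) = 0ℤ
δ (suc j) zero    = 0ℤ
δ (suc j) (suc k) = δ j k

absDiff : ℕ → ℕ → ℕ
absDiff m n = ∣ m - n ∣

legendre3 : ℕ → ℤ
legendre3 m with m % 3
... | 0 = 0ℤ
... | 1 = 1ℤ
... | _ = - 1ℤ

M : (n : ℕ) → Matrix n
M n j k = ((+ 2) ^ absDiff (toℕ j) (toℕ k)) + δ j k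

{-# OPTIONS --safe #-}
-- Adding −2 times row 1 to row 0 of M (n+2) leaves the first row (−2, −2, 0, …, 0), so
-- det M (n+2) is a combination of two minors: M (n+1), and M (n+1) with its first
-- column replaced by a geometric column, whose determinant is linear in that column.
-- Tracking both gives the coupled recurrence
--   d (n+1) = −2 d n + 4 p n,   p (n+1) = −3 d n + 4 p n,
-- whose companion matrix has characteristic polynomial λ² − 2λ + 4, a divisor of
-- λ³ + 8.  Hence d (n+3) = −8 d n, and the closed form follows from three initial
-- values.  The row operation is justified by the vanishing of alien cofactors.
module Submission where

open import Defs
open import Data.Nat as ℕ using (ℕ; zero; suc)
open import Data.Integer using (ℤ; +_; -[1+_]; -_; _-_; _*_; _^_; 0ℤ; 1ℤ)
open import Data.Fin using (Fin; zero; suc; toℕ; punchIn; punchOut)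
open import Data.Fin.Properties using (punchOut-cong; suc-injective)
open import Function using (_∘_)
open import Relation.Binary.PropositionalEquality
  using (_≡_; _≢_; refl; sym; trans; cong; cong₂; module ≡-Reasoning)

module LaplaceExpansion where
  open import Data.Integer using (_+_)
  open import Data.Integer.Properties using (+-identityʳ; +-inverseʳ; *-zeroʳ)
  open import Data.Integer.Tactic.RingSolver using (solve-∀)
  open ≡-Reasoning

  altSum-cong : ∀ {m} {f g : Fin m → ℤ} → (∀ j → f j ≡ g j) → altSum f ≡ altSum g
  altSum-cong {zero}  f≗g = refl
  altSum-cong {suc m} f≗g = cong₂ _-_ (f≗g zero) (altSum-cong (f≗g ∘ suc))

  altSum-+ : ∀ {m} (f g : Fin m → ℤ) → altSum (λ j → f j + g j) ≡ altSum f + altSum g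
  altSum-+ {zero}  f g = refl
  altSum-+ {suc m} f g =
    trans (cong (λ t → (f zero + g zero) - t) (altSum-+ (f ∘ suc) (g ∘ suc)))
          (interchange (f zero) (g zero) _ _)
    where
    interchange : ∀ a b c d → (a + b) - (c + d) ≡ (a - c) + (b - d)
    interchange = solve-∀

  altSum-neg : ∀ {m} (f : Fin m → ℤ) → altSum (λ j → - f j) ≡ - altSum f
  altSum-neg {zero}  f = refl
  altSum-neg {suc m} f =
    trans (cong (λ t → - f zero - t) (altSum-neg (f ∘ suc))) (neg-distrib-− (f zero) _)
    where
    neg-distrib-− : ∀ a b → - a - - b ≡ - (a - b)
    neg-distrib-− = solve-∀

  altSum-− : ∀ {m} (f g : Fin m → ℤ) → altSum (λ j → f j - g j) ≡ altSum f - altSum g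
  altSum-− f g = trans (altSum-+ f (λ j → - g j)) (cong (λ t → altSum f + t) (altSum-neg g))

  altSum-*ˡ : ∀ {m} c (f : Fin m → ℤ) → altSum (λ j → c * f j) ≡ c * altSum f
  altSum-*ˡ {zero}  c f = sym (*-zeroʳ c)
  altSum-*ˡ {suc m} c f =
    trans (cong (λ t → c * f zero - t) (altSum-*ˡ c (f ∘ suc))) (*-distribˡ-− c (f zero) _)
    where
    *-distribˡ-− : ∀ c a b → c * a - c * b ≡ c * (a - b)
    *-distribˡ-− = solve-∀

  altSum-zero : ∀ m → altSum {m} (λ _ → 0ℤ) ≡ 0ℤ
  altSum-zero zero    = refl
  altSum-zero (suc m) = cong (λ t → 0ℤ - t) (altSum-zero m)

  altSum-firstTwo : ∀ {m} (f : Fin (suc (suc m)) → ℤ) → (∀ j → f (suc (suc j)) ≡ 0ℤ) →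
                    altSum f ≡ f zero - f (suc zero)
  altSum-firstTwo {m} f tail≡0 =
    trans (cong (λ t → f zero - (f (suc zero) - t)) (trans (altSum-cong tail≡0) (altSum-zero m)))
          (cong (λ t → f zero - t) (+-identityʳ (f (suc zero))))

  det-cong : ∀ {n} {A B : Matrix n} → (∀ i j → A i j ≡ B i j) → det A ≡ det B
  det-cong {zero}          A≗B = refl
  det-cong {suc n} {A} {B} A≗B =
    altSum-cong λ j → cong₂ _*_ (A≗B zero j)
                                (det-cong {A = minor A j} {B = minor B j} λ r c →
                                   A≗B (suc r) (punchIn j c))

  -- Deleting column j and then column k of what remains deletes the same two columns as
  -- deleting punchIn j k first; column j then sits at position punchOut p.
  punchIn-punchIn-swap : ∀ {n} (j : Fin (suc (suc n))) (k : Fin (suc n)) (p : punchIn j k ≢ j)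
                         (c : Fin n) →
                         punchIn j (punchIn k c) ≡ punchIn (punchIn j k) (punchIn (punchOut p) c)
  punchIn-punchIn-swap zero    k       p c       = refl
  punchIn-punchIn-swap (suc j) zero    p c       = refl
  punchIn-punchIn-swap (suc j) (suc k) p zero    = refl
  punchIn-punchIn-swap (suc j) (suc k) p (suc c) =
    cong suc (punchIn-punchIn-swap j k (p ∘ cong suc) c)

  -- In the double sum over an ordered pair of deleted positions (j , punchIn j k) the terms
  -- for (j , k) and (punchIn j k , punchOut _) carry opposite signs and cancel.
  altSum-pairs-cancel : ∀ {n} (a : Fin (suc n) → ℤ) (G : Fin (suc n) → Fin n → ℤ) →
                        (∀ j k (p : punchIn j k ≢ j) → G j k ≡ G (punchIn j k) (punchOut p)) →
                        altSum (λ j → a j * altSum (λ k → a (punchIn j k) * G j k)) ≡ 0ℤ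
  altSum-pairs-cancel {zero}  a G G-swap = trans (+-identityʳ (a zero * 0ℤ)) (*-zeroʳ (a zero))
  altSum-pairs-cancel {suc n} a G G-swap =
    trans (cong (λ t → a zero * X - t) rest≡a₀X) (+-inverseʳ (a zero * X))
    where
    X : ℤ
    X = altSum (λ k → a (suc k) * G zero k)

    S : Fin (suc n) → ℤ
    S j = altSum (λ k → a (suc (punchIn j k)) * G (suc j) (suc k))

    inner-cancel : altSum (λ j → a (suc j) * S j) ≡ 0ℤ
    inner-cancel = altSum-pairs-cancel (a ∘ suc) (λ j k → G (suc j) (suc k)) λ j k p →
      trans (G-swap (suc j) (suc k) (p ∘ suc-injective))
            (cong (G (suc (punchIn j k)) ∘ suc) (punchOut-cong (punchIn j k) refl))

    distrib : ∀ x a₀ g s → x * (a₀ * g - s) ≡ a₀ * (x * g) - x * s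
    distrib = solve-∀

    rest≡a₀X : altSum (λ j → a (suc j) * (a zero * G (suc j) zero - S j)) ≡ a zero * X
    rest≡a₀X = begin
      altSum (λ j → a (suc j) * (a zero * G (suc j) zero - S j))
        ≡⟨ altSum-cong (λ j → distrib (a (suc j)) (a zero) (G (suc j) zero) (S j)) ⟩
      altSum (λ j → a zero * (a (suc j) * G (suc j) zero) - a (suc j) * S j)
        ≡⟨ altSum-− (λ j → a zero * (a (suc j) * G (suc j) zero)) (λ j → a (suc j) * S j) ⟩
      altSum (λ j → a zero * (a (suc j) * G (suc j) zero)) - altSum (λ j → a (suc j) * S j)
        ≡⟨ cong₂ _-_ (altSum-*ˡ (a zero) (λ j → a (suc j) * G (suc j) zero)) inner-cancel ⟩
      a zero * altSum (λ j → a (suc j) * G (suc j) zero) - 0ℤ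
        ≡⟨ +-identityʳ _ ⟩
      a zero * altSum (λ j → a (suc j) * G (suc j) zero)
        ≡⟨ cong (a zero *_) (altSum-cong λ j → cong (a (suc j) *_) (sym (G-swap zero j λ ()))) ⟩
      a zero * X ∎

  alien-cofactors : ∀ {n} (A : Matrix (suc (suc n))) →
                    altSum (λ j → A (suc zero) j * det (minor A j)) ≡ 0ℤ
  alien-cofactors A =
    altSum-pairs-cancel (A (suc zero)) (λ j k → det (minor (minor A j) k)) λ j k p →
      det-cong λ r c → cong (A (suc (suc r))) (punchIn-punchIn-swap j k p c)

  addRow₁ : ∀ {n} → ℤ → Matrix (suc (suc n)) → Matrix (suc (suc n))
  addRow₁ c A zero    j = A zero j + c * A (suc zero) j
  addRow₁ c A (suc r) j = A (suc r) j

  det-addRow₁ : ∀ {n} c (A : Matrix (suc (suc n))) → det (addRow₁ c A) ≡ det A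
  det-addRow₁ c A = begin
    altSum (λ j → (A zero j + c * A (suc zero) j) * D j)
      ≡⟨ altSum-cong (λ j → distrib (A zero j) c (A (suc zero) j) (D j)) ⟩
    altSum (λ j → A zero j * D j + c * (A (suc zero) j * D j))
      ≡⟨ altSum-+ (λ j → A zero j * D j) (λ j → c * (A (suc zero) j * D j)) ⟩
    det A + altSum (λ j → c * (A (suc zero) j * D j))
      ≡⟨ cong (λ t → det A + t) (altSum-*ˡ c (λ j → A (suc zero) j * D j)) ⟩
    det A + c * altSum (λ j → A (suc zero) j * D j)
      ≡⟨ cong (λ t → det A + c * t) (alien-cofactors A) ⟩
    det A + c * 0ℤ
      ≡⟨ trans (cong (λ t → det A + t) (*-zeroʳ c)) (+-identityʳ (det A)) ⟩
    det A ∎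
    where
    D : Fin _ → ℤ
    D j = det (minor A j)

    distrib : ∀ a c b d → (a + c * b) * d ≡ a * d + c * (b * d)
    distrib = solve-∀

  det-twoTermExpansion :
    ∀ {n} c (A : Matrix (suc (suc n))) →
    (∀ j → A zero (suc (suc j)) + c * A (suc zero) (suc (suc j)) ≡ 0ℤ) →
    det A ≡ (A zero zero + c * A (suc zero) zero) * det (minor A zero)
          - (A zero (suc zero) + c * A (suc zero) (suc zero)) * det (minor A (suc zero))
  det-twoTermExpansion c A row₀+c·row₁≡0 =
    trans (sym (det-addRow₁ c A))
          (altSum-firstTwo (λ j → addRow₁ c A zero j * det (minor A j)) λ j →
             cong (_* det (minor A (suc (suc j)))) (row₀+c·row₁≡0 j))

module DeterminantOfM where
  open import Data.Integer using (_+_)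
  open import Data.Integer.Properties using (+-identityʳ)
  open import Data.Integer.Tactic.RingSolver using (solve-∀)
  open ≡-Reasoning
  open LaplaceExpansion using (det-cong; det-twoTermExpansion)

  M₀ : ℤ → (m : ℕ) → Matrix m
  M₀ x m r zero    = x * (+ 2) ^ toℕ r
  M₀ x m r (suc c) = M m r (suc c)

  M-row₀-twiceRow₁ : ∀ n (j : Fin n) →
    M (suc (suc n)) zero (suc (suc j)) + -[1+ 1 ] * M (suc (suc n)) (suc zero) (suc (suc j)) ≡ 0ℤ
  M-row₀-twiceRow₁ n j = cancel ((+ 2) ^ toℕ j)
    where
    cancel : ∀ y → (+ 2 * (+ 2 * y) + 0ℤ) + -[1+ 1 ] * (+ 2 * y + 0ℤ) ≡ 0ℤ
    cancel = solve-∀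

  minor₁-M : ∀ n r c → minor (M (suc (suc n))) (suc zero) r c ≡ M₀ (+ 2) (suc n) r c
  minor₁-M n r zero    = +-identityʳ _
  minor₁-M n r (suc c) = refl

  minor₁-M₀ : ∀ x n r c → minor (M₀ x (suc (suc n))) (suc zero) r c ≡ M₀ (+ 2 * x) (suc n) r c
  minor₁-M₀ x n r zero    = reassoc x ((+ 2) ^ toℕ r)
    where
    reassoc : ∀ x y → x * (+ 2 * y) ≡ (+ 2 * x) * y
    reassoc = solve-∀
  minor₁-M₀ x n r (suc c) = refl

  d p : ℕ → ℤ
  d zero    = + 2
  d (suc n) = -[1+ 1 ] * d n + + 4 * p n
  p zero    = 1ℤ
  p (suc n) = -[1+ 2 ] * d n + + 4 * p n

  det-M  : ∀ n → det (M (suc n)) ≡ d n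
  det-M₀ : ∀ n x → det (M₀ x (suc n)) ≡ x * p n

  det-M zero    = refl
  det-M (suc n) = begin
    det (M (suc (suc n)))
      ≡⟨ det-twoTermExpansion -[1+ 1 ] (M (suc (suc n))) (M-row₀-twiceRow₁ n) ⟩
    -[1+ 1 ] * det (M (suc n)) - -[1+ 1 ] * det (minor (M (suc (suc n))) (suc zero))
      ≡⟨ cong₂ (λ u v → -[1+ 1 ] * u - -[1+ 1 ] * v)
               (det-M n) (trans (det-cong (minor₁-M n)) (det-M₀ n (+ 2))) ⟩
    -[1+ 1 ] * d n - -[1+ 1 ] * (+ 2 * p n)
      ≡⟨ simplify (d n) (p n) ⟩
    d (suc n) ∎
    where
    simplify : ∀ d p → -[1+ 1 ] * d - -[1+ 1 ] * (+ 2 * p) ≡ -[1+ 1 ] * d + + 4 * p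
    simplify = solve-∀

  det-M₀ zero    x = unit x
    where
    unit : ∀ x → x * 1ℤ * 1ℤ - 0ℤ ≡ x * 1ℤ
    unit = solve-∀
  det-M₀ (suc n) x = begin
    det (M₀ x (suc (suc n)))
      ≡⟨ det-twoTermExpansion -[1+ 1 ] (M₀ x (suc (suc n))) (M-row₀-twiceRow₁ n) ⟩
    (x * 1ℤ + -[1+ 1 ] * (x * + 2)) * det (M (suc n))
      - -[1+ 1 ] * det (minor (M₀ x (suc (suc n))) (suc zero))
      ≡⟨ cong₂ (λ u v → (x * 1ℤ + -[1+ 1 ] * (x * + 2)) * u - -[1+ 1 ] * v)
               (det-M n) (trans (det-cong (minor₁-M₀ x n)) (det-M₀ n (+ 2 * x))) ⟩
    (x * 1ℤ + -[1+ 1 ] * (x * + 2)) * d n - -[1+ 1 ] * ((+ 2 * x) * p n)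
      ≡⟨ simplify x (d n) (p n) ⟩
    x * p (suc n) ∎
    where
    simplify : ∀ x d p → (x * 1ℤ + -[1+ 1 ] * (x * + 2)) * d - -[1+ 1 ] * ((+ 2 * x) * p)
                         ≡ x * (-[1+ 2 ] * d + + 4 * p)
    simplify = solve-∀

  d-recurrence : ∀ n → d (suc (suc n)) ≡ + 2 * d (suc n) - + 4 * d n
  d-recurrence n = eliminate-p (d n) (p n)
    where
    eliminate-p : ∀ d p → -[1+ 1 ] * (-[1+ 1 ] * d + + 4 * p) + + 4 * (-[1+ 2 ] * d + + 4 * p)
                          ≡ + 2 * (-[1+ 1 ] * d + + 4 * p) - + 4 * d
    eliminate-p = solve-∀

  d-period : ∀ n → d (3 ℕ.+ n) ≡ -[1+ 7 ] * d n
  d-period n = begin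
    d (3 ℕ.+ n)
      ≡⟨ d-recurrence (suc n) ⟩
    + 2 * d (2 ℕ.+ n) - + 4 * d (1 ℕ.+ n)
      ≡⟨ cong (λ t → + 2 * t - + 4 * d (1 ℕ.+ n)) (d-recurrence n) ⟩
    + 2 * (+ 2 * d (1 ℕ.+ n) - + 4 * d n) - + 4 * d (1 ℕ.+ n)
      ≡⟨ collect (d (1 ℕ.+ n)) (d n) ⟩
    -[1+ 7 ] * d n ∎
    where
    collect : ∀ a b → + 2 * (+ 2 * a - + 4 * b) - + 4 * a ≡ -[1+ 7 ] * b
    collect = solve-∀

  legendre3-periodic : ∀ m → legendre3 (3 ℕ.+ m) ≡ legendre3 m
  legendre3-periodic m = refl

  d-closedForm : ∀ n → d n ≡ (-[1+ 1 ] ^ suc n) * legendre3 (suc n ℕ.+ 1)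
  d-closedForm 0 = refl
  d-closedForm 1 = refl
  d-closedForm 2 = refl
  d-closedForm (suc (suc (suc n))) = begin
    d (3 ℕ.+ n)
      ≡⟨ d-period n ⟩
    -[1+ 7 ] * d n
      ≡⟨ cong (-[1+ 7 ] *_) (d-closedForm n) ⟩
    -[1+ 7 ] * ((-[1+ 1 ] ^ suc n) * legendre3 (suc n ℕ.+ 1))
      ≡⟨ regroup (-[1+ 1 ] ^ suc n) (legendre3 (suc n ℕ.+ 1)) ⟩
    (-[1+ 1 ] ^ (4 ℕ.+ n)) * legendre3 (suc n ℕ.+ 1)
      ≡⟨ cong ((-[1+ 1 ] ^ (4 ℕ.+ n)) *_) (sym (legendre3-periodic (suc n ℕ.+ 1))) ⟩
    (-[1+ 1 ] ^ (4 ℕ.+ n)) * legendre3 (4 ℕ.+ n ℕ.+ 1) ∎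
    where
    regroup : ∀ y L → -[1+ 7 ] * (y * L) ≡ (-[1+ 1 ] * (-[1+ 1 ] * (-[1+ 1 ] * y))) * L
    regroup = solve-∀

open DeterminantOfM using (det-M; d-closedForm)
open import Data.Nat using (_+_)

corollary1p11 : (n : ℕ) → det (M (suc n)) ≡ (-[1+ 1 ] ^ suc n) * legendre3 (suc n + 1)
corollary1p11 n = trans (det-M n) (d-closedForm n)
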